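{- Let $A$ be an MV-algebra in the variety $V(C)$. Then $B(A)\subseteq\theta(A)$ (in particular $0,1\in\theta(A)$), $Rad(A)\subseteq\theta(A)$, and $\{\neg x: x\in Rad(A)\}\cap\theta(A)=\{1\}$. Moreover, for every $x\in A$, $x\in\theta(A)$ if and only if $x=b\oplus\varepsilon$ for some $b\in B(A)$ and some $\varepsilon\in Rad(A)$.
   Context: An MV-algebra is a structure $(A,\oplus,\neg,0)$ where $(A,\oplus,0)$ is a commutative monoid, $\neg\neg x=x$, $x\oplus \neg 0=\neg 0$, and $\neg(\neg x\oplus y)\oplus y=\neg(\neg y\oplus x)\oplus x$; put $1=\neg 0$, $x\odot y=\neg(\neg x\oplus\neg y)$, $2x=x\oplus x$, $x^2=x\odot x$, $nx=x\oplus\cdots\oplus x$ ($n$ times), with the order $x\le y$ iff $y=x\oplus z$ for some $z$. $V(C)$ is the variety of MV-algebras generated by Chang's algebra $C=\Gamma(\mathbb Z\times_{lex}\mathbb Z,(1,0))$, axiomatized relative to MV-algebras by $(2x)^2=2(x^2)$. $B(A)=\{x\in A: x\oplus x=x\}$ is the Boolean part of $A$; an element $x$ is infinitesimal if $nx\le\neg x$ for all positive integers $n$, and $Rad(A)$ is the set of infinitesimals. $\theta(A)=\{x\in A: x\ge 2x^2\}$. -}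

module Defs where

open import Level using (Level; suc; _⊔_)
open import Data.Nat using (ℕ; zero) renaming (suc to sucℕ)
open import Data.Product using (Σ; ∃; _×_; _,_)
open import Relation.Binary.PropositionalEquality using (_≡_)

record MVAlgebra (a : Level) : Set (suc a) where
  infixl 6 _⊕_
  field
    Carrier : Set a
    _⊕_     : Carrier → Carrier → Carrier
    ¬_      : Carrier → Carrier
    𝟘       : Carrier
    ⊕-assoc    : ∀ x y z → (x ⊕ y) ⊕ z ≡ x ⊕ (y ⊕ z)
    ⊕-comm     : ∀ x y → x ⊕ y ≡ y ⊕ x
    ⊕-identityʳ : ∀ x → x ⊕ 𝟘 ≡ x
    ¬¬-involutive : ∀ x → ¬ (¬ x) ≡ x
    ⊕-absorb   : ∀ x → x ⊕ (¬ 𝟘) ≡ ¬ 𝟘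
    luk        : ∀ x y → (¬ (¬ x ⊕ y)) ⊕ y ≡ (¬ (¬ y ⊕ x)) ⊕ x

  𝟙 : Carrier
  𝟙 = ¬ 𝟘

  _⊙_ : Carrier → Carrier → Carrier
  x ⊙ y = ¬ (¬ x ⊕ ¬ y)

  _·_ : ℕ → Carrier → Carrier
  zero · x = 𝟘
  sucℕ n · x = x ⊕ (n · x)

  _≤_ : Carrier → Carrier → Set a
  x ≤ y = Σ Carrier λ z → y ≡ x ⊕ z

  IsBoolean : Carrier → Set a
  IsBoolean x = x ⊕ x ≡ x

  IsInfinitesimal : Carrier → Set a
  IsInfinitesimal x = ∀ (n : ℕ) → (sucℕ n · x) ≤ (¬ x)

  InTheta : Carrier → Set a
  InTheta x = (2 · (x ⊙ x)) ≤ x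

InVC : ∀ {a} → MVAlgebra a → Set a
InVC A = ∀ x → (2 · x) ⊙ (2 · x) ≡ 2 · (x ⊙ x)
  where open MVAlgebra A

{-# OPTIONS --safe #-}
-- In V(C) the element 2(x²) is always Boolean: x² and (¬x)² are disjoint in every
-- MV-algebra, doubling preserves disjointness, and the defining identity of V(C) turns
-- 2((¬x)²) into ¬(2(x²)).  For x ∈ θ(A) this gives x = b ⊕ ε with b = 2(x²) and
-- ε = x ⊙ ¬b, where ε² = x² ⊙ ¬b = 0; and in V(C) an element of zero square is
-- infinitesimal, because (2y)² = 2(y²) propagates y² = 0 to all multiples of y.
-- Conversely, if x = b ⊕ ε then x ⊙ ¬b ≤ ε, so x² ⊙ ¬b = (x ⊙ ¬b)² = 0, i.e. x² ≤ b and
-- 2(x²) ≤ b ≤ x.  Finally, for infinitesimal x we get 2((¬x)²) = ¬(2(x²)) = 1, so ¬x ∈ θ(A)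
-- forces ¬x = 1.
module Submission where

open import Defs
open import Level using (Level)
open import Data.Nat using (zero; suc)
open import Data.Product using (Σ; _×_; _,_)
open import Function.Bundles using (_⇔_; mk⇔)
open import Relation.Binary.PropositionalEquality
  using (_≡_; refl; sym; trans; cong; cong₂; subst; subst₂; isEquivalence; module ≡-Reasoning)
open import Algebra.Core using (Op₂)
open import Algebra.Bundles using (CommutativeSemigroup)
import Algebra.Properties.CommutativeSemigroup as CommutativeSemigroupProperties

module MVAlgebraProperties {a : Level} (A : MVAlgebra a) where
  open MVAlgebra A
    renaming (¬_ to infix 8 ¬_; _⊙_ to infixl 7 _⊙_; _·_ to infixr 9 _·_; _≤_ to infix 4 _≤_)
  open ≡-Reasoning

  ⊕-identityˡ : ∀ x → 𝟘 ⊕ x ≡ x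
  ⊕-identityˡ x = trans (⊕-comm 𝟘 x) (⊕-identityʳ x)

  ⊕-zeroˡ : ∀ x → 𝟙 ⊕ x ≡ 𝟙
  ⊕-zeroˡ x = trans (⊕-comm 𝟙 x) (⊕-absorb x)

  ¬𝟙≡𝟘 : ¬ 𝟙 ≡ 𝟘
  ¬𝟙≡𝟘 = ¬¬-involutive 𝟘

  ¬-⊙ : ∀ x y → ¬ (x ⊙ y) ≡ ¬ x ⊕ ¬ y
  ¬-⊙ x y = ¬¬-involutive (¬ x ⊕ ¬ y)

  ¬-⊕ : ∀ x y → ¬ (x ⊕ y) ≡ ¬ x ⊙ ¬ y
  ¬-⊕ x y = cong ¬_ (sym (cong₂ _⊕_ (¬¬-involutive x) (¬¬-involutive y)))

  ⊕-inverseˡ : ∀ x → ¬ x ⊕ x ≡ 𝟙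
  ⊕-inverseˡ x = begin
    ¬ x ⊕ x          ≡⟨ cong (λ t → ¬ t ⊕ x) (sym (trans (cong (_⊕ x) ¬𝟙≡𝟘) (⊕-identityˡ x))) ⟩
    ¬ (¬ 𝟙 ⊕ x) ⊕ x  ≡⟨ luk 𝟙 x ⟩
    ¬ (¬ x ⊕ 𝟙) ⊕ 𝟙  ≡⟨ ⊕-absorb _ ⟩
    𝟙                ∎

  ⊕-inverseʳ : ∀ x → x ⊕ ¬ x ≡ 𝟙
  ⊕-inverseʳ x = trans (⊕-comm x (¬ x)) (⊕-inverseˡ x)

  ⊙-comm : ∀ x y → x ⊙ y ≡ y ⊙ x
  ⊙-comm x y = cong ¬_ (⊕-comm (¬ x) (¬ y))

  ⊙-assoc : ∀ x y z → (x ⊙ y) ⊙ z ≡ x ⊙ (y ⊙ z)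
  ⊙-assoc x y z = cong ¬_ (begin
    ¬ (x ⊙ y) ⊕ ¬ z      ≡⟨ cong (_⊕ ¬ z) (¬-⊙ x y) ⟩
    (¬ x ⊕ ¬ y) ⊕ ¬ z    ≡⟨ ⊕-assoc (¬ x) (¬ y) (¬ z) ⟩
    ¬ x ⊕ (¬ y ⊕ ¬ z)    ≡⟨ cong (¬ x ⊕_) (sym (¬-⊙ y z)) ⟩
    ¬ x ⊕ ¬ (y ⊙ z)      ∎)

  ⊙-inverseʳ : ∀ x → x ⊙ ¬ x ≡ 𝟘
  ⊙-inverseʳ x = trans (cong ¬_ (trans (cong (¬ x ⊕_) (¬¬-involutive x)) (⊕-inverseˡ x))) ¬𝟙≡𝟘

  ⊙-zeroʳ : ∀ x → x ⊙ 𝟘 ≡ 𝟘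
  ⊙-zeroʳ x = trans (cong ¬_ (⊕-absorb (¬ x))) ¬𝟙≡𝟘

  private
    commutativeSemigroup : (_∙_ : Op₂ Carrier) →
      (∀ x y z → (x ∙ y) ∙ z ≡ x ∙ (y ∙ z)) → (∀ x y → x ∙ y ≡ y ∙ x) →
      CommutativeSemigroup a a
    commutativeSemigroup _∙_ assoc comm = record
      { _∙_ = _∙_
      ; isCommutativeSemigroup = record
        { isSemigroup = record
          { isMagma = record { isEquivalence = isEquivalence ; ∙-cong = cong₂ _∙_ }
          ; assoc   = assoc
          }
        ; comm = comm
        }
      }

  open CommutativeSemigroupProperties (commutativeSemigroup _⊕_ ⊕-assoc ⊕-comm) public
    using () renaming (interchange to ⊕-interchange)
  open CommutativeSemigroupProperties (commutativeSemigroup _⊙_ ⊙-assoc ⊙-comm) public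
    using () renaming (interchange to ⊙-interchange)

  2·x≡x⊕x : ∀ x → 2 · x ≡ x ⊕ x
  2·x≡x⊕x x = cong (x ⊕_) (⊕-identityʳ x)

  2·𝟘≡𝟘 : 2 · 𝟘 ≡ 𝟘
  2·𝟘≡𝟘 = trans (2·x≡x⊕x 𝟘) (⊕-identityʳ 𝟘)

  ⊕-luk : ∀ p q → p ⊕ (q ⊙ ¬ p) ≡ q ⊕ (p ⊙ ¬ q)
  ⊕-luk p q = begin
    p ⊕ (q ⊙ ¬ p)      ≡⟨ ⊕-comm p _ ⟩
    (q ⊙ ¬ p) ⊕ p      ≡⟨ cong (λ t → ¬ (¬ q ⊕ t) ⊕ p) (¬¬-involutive p) ⟩
    ¬ (¬ q ⊕ p) ⊕ p    ≡⟨ luk q p ⟩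
    ¬ (¬ p ⊕ q) ⊕ q    ≡⟨ cong (λ t → ¬ (¬ p ⊕ t) ⊕ q) (sym (¬¬-involutive q)) ⟩
    (p ⊙ ¬ q) ⊕ q      ≡⟨ ⊕-comm _ q ⟩
    q ⊕ (p ⊙ ¬ q)      ∎

  ⊙-luk : ∀ p q → (p ⊕ ¬ q) ⊙ q ≡ (q ⊕ ¬ p) ⊙ p
  ⊙-luk p q = cong ¬_ (begin
    ¬ (p ⊕ ¬ q) ⊕ ¬ q          ≡⟨ cong (λ t → ¬ (t ⊕ ¬ q) ⊕ ¬ q) (sym (¬¬-involutive p)) ⟩
    ¬ (¬ (¬ p) ⊕ ¬ q) ⊕ ¬ q    ≡⟨ luk (¬ p) (¬ q) ⟩
    ¬ (¬ (¬ q) ⊕ ¬ p) ⊕ ¬ p    ≡⟨ cong (λ t → ¬ (t ⊕ ¬ p) ⊕ ¬ p) (¬¬-involutive q) ⟩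
    ¬ (q ⊕ ¬ p) ⊕ ¬ p          ∎)

  ≤-refl : ∀ {x} → x ≤ x
  ≤-refl {x} = 𝟘 , sym (⊕-identityʳ x)

  ≤-trans : ∀ {x y z} → x ≤ y → y ≤ z → x ≤ z
  ≤-trans {x} (u , y≡x⊕u) (v , z≡y⊕v) =
    u ⊕ v , trans z≡y⊕v (trans (cong (_⊕ v) y≡x⊕u) (⊕-assoc x u v))

  ≤-minimum : ∀ x → 𝟘 ≤ x
  ≤-minimum x = x , sym (⊕-identityˡ x)

  ≤-maximum : ∀ x → x ≤ 𝟙
  ≤-maximum x = ¬ x , sym (⊕-inverseʳ x)

  𝟙≤⇒≡𝟙 : ∀ {x} → 𝟙 ≤ x → x ≡ 𝟙
  𝟙≤⇒≡𝟙 (u , x≡𝟙⊕u) = trans x≡𝟙⊕u (⊕-zeroˡ u)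

  ⊕-mono-≤ : ∀ {x y u v} → x ≤ y → u ≤ v → x ⊕ u ≤ y ⊕ v
  ⊕-mono-≤ {x} {_} {u} (s , y≡x⊕s) (t , v≡u⊕t) =
    s ⊕ t , trans (cong₂ _⊕_ y≡x⊕s v≡u⊕t) (⊕-interchange x s u t)

  2·-mono-≤ : ∀ {x y} → x ≤ y → 2 · x ≤ 2 · y
  2·-mono-≤ x≤y = ⊕-mono-≤ x≤y (⊕-mono-≤ x≤y ≤-refl)

  ≤⇒⊙¬≡𝟘 : ∀ {x y} → x ≤ y → x ⊙ ¬ y ≡ 𝟘
  ≤⇒⊙¬≡𝟘 {x} {y} (u , y≡x⊕u) = begin
    ¬ (¬ x ⊕ ¬ (¬ y))    ≡⟨ cong (λ t → ¬ (¬ x ⊕ t)) (trans (¬¬-involutive y) y≡x⊕u) ⟩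
    ¬ (¬ x ⊕ (x ⊕ u))    ≡⟨ cong ¬_ (sym (⊕-assoc (¬ x) x u)) ⟩
    ¬ ((¬ x ⊕ x) ⊕ u)    ≡⟨ cong (λ t → ¬ (t ⊕ u)) (⊕-inverseˡ x) ⟩
    ¬ (𝟙 ⊕ u)            ≡⟨ cong ¬_ (⊕-zeroˡ u) ⟩
    ¬ 𝟙                  ≡⟨ ¬𝟙≡𝟘 ⟩
    𝟘                    ∎

  ⊙¬≡𝟘⇒≡⊕⊙¬ : ∀ {x y} → x ⊙ ¬ y ≡ 𝟘 → y ≡ x ⊕ (y ⊙ ¬ x)
  ⊙¬≡𝟘⇒≡⊕⊙¬ {x} {y} x⊙¬y≡𝟘 = begin
    y                ≡⟨ sym (⊕-identityʳ y) ⟩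
    y ⊕ 𝟘            ≡⟨ cong (y ⊕_) (sym x⊙¬y≡𝟘) ⟩
    y ⊕ (x ⊙ ¬ y)    ≡⟨ ⊕-luk y x ⟩
    x ⊕ (y ⊙ ¬ x)    ∎

  ⊙¬≡𝟘⇒≤ : ∀ {x y} → x ⊙ ¬ y ≡ 𝟘 → x ≤ y
  ⊙¬≡𝟘⇒≤ {x} {y} x⊙¬y≡𝟘 = y ⊙ ¬ x , ⊙¬≡𝟘⇒≡⊕⊙¬ x⊙¬y≡𝟘

  ≤⇒≡⊕⊙¬ : ∀ {x y} → x ≤ y → y ≡ x ⊕ (y ⊙ ¬ x)
  ≤⇒≡⊕⊙¬ x≤y = ⊙¬≡𝟘⇒≡⊕⊙¬ (≤⇒⊙¬≡𝟘 x≤y)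

  ≤-antisym : ∀ {x y} → x ≤ y → y ≤ x → x ≡ y
  ≤-antisym {x} {y} x≤y y≤x = begin
    x                ≡⟨ ⊙¬≡𝟘⇒≡⊕⊙¬ (≤⇒⊙¬≡𝟘 y≤x) ⟩
    y ⊕ (x ⊙ ¬ y)    ≡⟨ cong (y ⊕_) (≤⇒⊙¬≡𝟘 x≤y) ⟩
    y ⊕ 𝟘            ≡⟨ ⊕-identityʳ y ⟩
    y                ∎

  ≤¬⇒⊙≡𝟘 : ∀ {x y} → x ≤ ¬ y → x ⊙ y ≡ 𝟘
  ≤¬⇒⊙≡𝟘 {x} {y} x≤¬y = trans (cong (x ⊙_) (sym (¬¬-involutive y))) (≤⇒⊙¬≡𝟘 x≤¬y)

  ⊙≡𝟘⇒≤¬ : ∀ {x y} → x ⊙ y ≡ 𝟘 → x ≤ ¬ y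
  ⊙≡𝟘⇒≤¬ {x} {y} x⊙y≡𝟘 = ⊙¬≡𝟘⇒≤ (trans (cong (x ⊙_) (¬¬-involutive y)) x⊙y≡𝟘)

  ¬-antitone-≤ : ∀ {x y} → x ≤ y → ¬ y ≤ ¬ x
  ¬-antitone-≤ {x} {y} x≤y = ⊙≡𝟘⇒≤¬ (trans (⊙-comm (¬ y) x) (≤⇒⊙¬≡𝟘 x≤y))

  x⊙y≤x : ∀ x y → x ⊙ y ≤ x
  x⊙y≤x x y = ⊙¬≡𝟘⇒≤ (begin
    (x ⊙ y) ⊙ ¬ x    ≡⟨ cong (_⊙ ¬ x) (⊙-comm x y) ⟩
    (y ⊙ x) ⊙ ¬ x    ≡⟨ ⊙-assoc y x (¬ x) ⟩
    y ⊙ (x ⊙ ¬ x)    ≡⟨ cong (y ⊙_) (⊙-inverseʳ x) ⟩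
    y ⊙ 𝟘            ≡⟨ ⊙-zeroʳ y ⟩
    𝟘                ∎)

  ⊕-absorbs-⊙ : ∀ x y → (x ⊕ y) ⊕ (x ⊙ y) ≡ x ⊕ y
  ⊕-absorbs-⊙ x y = sym (begin
    x ⊕ y                    ≡⟨ cong (x ⊕_) y≡x⊙y⊕w ⟩
    x ⊕ ((x ⊙ y) ⊕ w)        ≡⟨ cong (x ⊕_) (⊕-comm (x ⊙ y) w) ⟩
    x ⊕ (w ⊕ (x ⊙ y))        ≡⟨ sym (⊕-assoc x w (x ⊙ y)) ⟩
    (x ⊕ w) ⊕ (x ⊙ y)        ≡⟨ cong (_⊕ (x ⊙ y)) (sym x⊕y≡x⊕w) ⟩
    (x ⊕ y) ⊕ (x ⊙ y)        ∎)
    where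
    w : Carrier
    w = (¬ x ⊕ ¬ y) ⊙ y
    x⊕y≡x⊕w : x ⊕ y ≡ x ⊕ w
    x⊕y≡x⊕w = begin
      x ⊕ y                          ≡⟨ ≤⇒≡⊕⊙¬ (y , refl) ⟩
      x ⊕ ((x ⊕ y) ⊙ ¬ x)            ≡⟨ cong (λ t → x ⊕ (t ⊙ ¬ x)) (trans (⊕-comm x y) (cong (y ⊕_) (sym (¬¬-involutive x)))) ⟩
      x ⊕ ((y ⊕ ¬ (¬ x)) ⊙ ¬ x)      ≡⟨ cong (x ⊕_) (⊙-luk y (¬ x)) ⟩
      x ⊕ w                          ∎
    y≡x⊙y⊕w : y ≡ (x ⊙ y) ⊕ w
    y≡x⊙y⊕w = begin
      y                              ≡⟨ ≤⇒≡⊕⊙¬ (subst (_≤ y) (⊙-comm y x) (x⊙y≤x y x)) ⟩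
      (x ⊙ y) ⊕ (y ⊙ ¬ (x ⊙ y))      ≡⟨ cong (λ t → (x ⊙ y) ⊕ (y ⊙ t)) (¬-⊙ x y) ⟩
      (x ⊙ y) ⊕ (y ⊙ (¬ x ⊕ ¬ y))    ≡⟨ cong ((x ⊙ y) ⊕_) (⊙-comm y _) ⟩
      (x ⊙ y) ⊕ w                    ∎

  -- Lattice disjointness u ∧ v = 𝟘, where u ∧ v = u ⊙ (¬ u ⊕ v).
  Disjoint : Carrier → Carrier → Set a
  Disjoint u v = ¬ u ⊕ v ≡ ¬ u

  disjoint-sym : ∀ {u v} → Disjoint u v → Disjoint v u
  disjoint-sym {u} {v} ¬u⊕v≡¬u = begin
    ¬ v ⊕ u          ≡⟨ cong (¬ v ⊕_) (sym (¬¬-involutive u)) ⟩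
    ¬ v ⊕ ¬ (¬ u)    ≡⟨ sym (¬-⊙ v (¬ u)) ⟩
    ¬ (v ⊙ ¬ u)      ≡⟨ cong ¬_ (sym v≡v⊙¬u) ⟩
    ¬ v              ∎
    where
    v⊙[u⊕¬v]≡𝟘 : v ⊙ (u ⊕ ¬ v) ≡ 𝟘
    v⊙[u⊕¬v]≡𝟘 = begin
      v ⊙ (u ⊕ ¬ v)    ≡⟨ ⊙-comm v _ ⟩
      (u ⊕ ¬ v) ⊙ v    ≡⟨ ⊙-luk u v ⟩
      (v ⊕ ¬ u) ⊙ u    ≡⟨ cong (_⊙ u) (trans (⊕-comm v (¬ u)) ¬u⊕v≡¬u) ⟩
      ¬ u ⊙ u          ≡⟨ ⊙-comm (¬ u) u ⟩
      u ⊙ ¬ u          ≡⟨ ⊙-inverseʳ u ⟩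
      𝟘                ∎
    ¬[u⊕¬v]≡v⊙¬u : ¬ (u ⊕ ¬ v) ≡ v ⊙ ¬ u
    ¬[u⊕¬v]≡v⊙¬u = trans (¬-⊕ u (¬ v)) (trans (cong (¬ u ⊙_) (¬¬-involutive v)) (⊙-comm (¬ u) v))
    v≡v⊙¬u : v ≡ v ⊙ ¬ u
    v≡v⊙¬u = ≤-antisym (subst (v ≤_) ¬[u⊕¬v]≡v⊙¬u (⊙≡𝟘⇒≤¬ v⊙[u⊕¬v]≡𝟘)) (x⊙y≤x v (¬ u))

  disjoint-doubleʳ : ∀ {u v} → Disjoint u v → Disjoint u (v ⊕ v)
  disjoint-doubleʳ {u} {v} ¬u⊕v≡¬u = begin
    ¬ u ⊕ (v ⊕ v)    ≡⟨ sym (⊕-assoc (¬ u) v v) ⟩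
    (¬ u ⊕ v) ⊕ v    ≡⟨ cong (_⊕ v) ¬u⊕v≡¬u ⟩
    ¬ u ⊕ v          ≡⟨ ¬u⊕v≡¬u ⟩
    ¬ u              ∎

  disjoint-2· : ∀ {u v} → Disjoint u v → Disjoint (2 · u) (2 · v)
  disjoint-2· {u} {v} u⊥v = subst₂ Disjoint (sym (2·x≡x⊕x u)) (sym (2·x≡x⊕x v))
    (disjoint-doubleʳ (disjoint-sym (disjoint-doubleʳ (disjoint-sym u⊥v))))

  disjoint-squares : ∀ x → Disjoint (x ⊙ x) (¬ x ⊙ ¬ x)
  disjoint-squares x = begin
    ¬ (x ⊙ x) ⊕ ¬ x ⊙ ¬ x          ≡⟨ cong (_⊕ ¬ x ⊙ ¬ x) (¬-⊙ x x) ⟩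
    (¬ x ⊕ ¬ x) ⊕ ¬ x ⊙ ¬ x        ≡⟨ ⊕-absorbs-⊙ (¬ x) (¬ x) ⟩
    ¬ x ⊕ ¬ x                      ≡⟨ sym (¬-⊙ x x) ⟩
    ¬ (x ⊙ x)                      ∎

  disjoint-¬⇒boolean : ∀ {u} → Disjoint u (¬ u) → IsBoolean u
  disjoint-¬⇒boolean {u} u⊥¬u = subst (λ t → t ⊕ u ≡ t) (¬¬-involutive u) (disjoint-sym u⊥¬u)

  boolean⇒¬⊙¬≡¬ : ∀ {b} → IsBoolean b → ¬ b ⊙ ¬ b ≡ ¬ b
  boolean⇒¬⊙¬≡¬ {b} b⊕b≡b = trans (sym (¬-⊕ b b)) (cong ¬_ b⊕b≡b)

  ≤-square≡𝟘 : ∀ {x y} → x ≤ y → y ⊙ y ≡ 𝟘 → x ⊙ x ≡ 𝟘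
  ≤-square≡𝟘 x≤y y⊙y≡𝟘 = ≤¬⇒⊙≡𝟘 (≤-trans x≤y (≤-trans (⊙≡𝟘⇒≤¬ y⊙y≡𝟘) (¬-antitone-≤ x≤y)))

  infinitesimal⇒square≡𝟘 : ∀ {x} → IsInfinitesimal x → x ⊙ x ≡ 𝟘
  infinitesimal⇒square≡𝟘 {x} x-inf = ≤¬⇒⊙≡𝟘 (subst (_≤ ¬ x) (⊕-identityʳ x) (x-inf 0))

  IsBoolean⊕Infinitesimal : Carrier → Set a
  IsBoolean⊕Infinitesimal x =
    Σ Carrier λ b → Σ Carrier λ ε → IsBoolean b × IsInfinitesimal ε × x ≡ b ⊕ ε

  boolean⇒θ : ∀ {x} → IsBoolean x → InTheta x
  boolean⇒θ {x} x⊕x≡x = subst (2 · (x ⊙ x) ≤_) (trans (2·x≡x⊕x x) x⊕x≡x) (2·-mono-≤ (x⊙y≤x x x))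

  infinitesimal⇒θ : ∀ {x} → IsInfinitesimal x → InTheta x
  infinitesimal⇒θ {x} x-inf =
    subst (_≤ x) (sym (trans (cong (2 ·_) (infinitesimal⇒square≡𝟘 x-inf)) 2·𝟘≡𝟘)) (≤-minimum x)

  boolean⊕infinitesimal⇒θ : ∀ {x} → IsBoolean⊕Infinitesimal x → InTheta x
  boolean⊕infinitesimal⇒θ (b , ε , b⊕b≡b , ε-inf , refl) =
    ≤-trans (subst (2 · (x ⊙ x) ≤_) (trans (2·x≡x⊕x b) b⊕b≡b) (2·-mono-≤ x⊙x≤b)) (ε , refl)
    where
    x : Carrier
    x = b ⊕ ε
    x⊙¬b≤ε : x ⊙ ¬ b ≤ ε
    x⊙¬b≤ε = ⊙¬≡𝟘⇒≤ (begin
      x ⊙ ¬ b ⊙ ¬ ε      ≡⟨ ⊙-assoc x (¬ b) (¬ ε) ⟩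
      x ⊙ (¬ b ⊙ ¬ ε)    ≡⟨ cong (x ⊙_) (sym (¬-⊕ b ε)) ⟩
      x ⊙ ¬ x            ≡⟨ ⊙-inverseʳ x ⟩
      𝟘                  ∎)
    x⊙x≤b : x ⊙ x ≤ b
    x⊙x≤b = ⊙¬≡𝟘⇒≤ (begin
      x ⊙ x ⊙ ¬ b                ≡⟨ cong (x ⊙ x ⊙_) (sym (boolean⇒¬⊙¬≡¬ b⊕b≡b)) ⟩
      x ⊙ x ⊙ (¬ b ⊙ ¬ b)        ≡⟨ ⊙-interchange x x (¬ b) (¬ b) ⟩
      x ⊙ ¬ b ⊙ (x ⊙ ¬ b)        ≡⟨ ≤-square≡𝟘 x⊙¬b≤ε (infinitesimal⇒square≡𝟘 ε-inf) ⟩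
      𝟘                          ∎)

module VCProperties {a : Level} (A : MVAlgebra a) (inVC : InVC A) where
  open MVAlgebra A
    renaming (¬_ to infix 8 ¬_; _⊙_ to infixl 7 _⊙_; _·_ to infixr 9 _·_; _≤_ to infix 4 _≤_)
  open MVAlgebraProperties A
  open ≡-Reasoning

  ¬-2·square : ∀ x → ¬ (2 · (x ⊙ x)) ≡ 2 · (¬ x ⊙ ¬ x)
  ¬-2·square x = begin
    ¬ (2 · (x ⊙ x))           ≡⟨ cong ¬_ (2·x≡x⊕x (x ⊙ x)) ⟩
    ¬ (x ⊙ x ⊕ x ⊙ x)         ≡⟨ ¬-⊕ (x ⊙ x) (x ⊙ x) ⟩
    ¬ (x ⊙ x) ⊙ ¬ (x ⊙ x)     ≡⟨ cong (λ t → t ⊙ t) (trans (¬-⊙ x x) (sym (2·x≡x⊕x (¬ x)))) ⟩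
    2 · (¬ x) ⊙ 2 · (¬ x)     ≡⟨ inVC (¬ x) ⟩
    2 · (¬ x ⊙ ¬ x)           ∎

  2·square-boolean : ∀ x → IsBoolean (2 · (x ⊙ x))
  2·square-boolean x = disjoint-¬⇒boolean
    (subst (Disjoint (2 · (x ⊙ x))) (sym (¬-2·square x)) (disjoint-2· (disjoint-squares x)))

  2·-square≡𝟘 : ∀ {x} → x ⊙ x ≡ 𝟘 → 2 · x ⊙ 2 · x ≡ 𝟘
  2·-square≡𝟘 x⊙x≡𝟘 = trans (inVC _) (trans (cong (2 ·_) x⊙x≡𝟘) 2·𝟘≡𝟘)

  suc·-square≡𝟘 : ∀ {x} → x ⊙ x ≡ 𝟘 → ∀ n → suc n · x ⊙ suc n · x ≡ 𝟘
  suc·-square≡𝟘 {x} x⊙x≡𝟘 zero    = subst (λ t → t ⊙ t ≡ 𝟘) (sym (⊕-identityʳ x)) x⊙x≡𝟘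
  suc·-square≡𝟘 {x} x⊙x≡𝟘 (suc n) =
    ≤-square≡𝟘 (⊕-mono-≤ (n · x , refl) (𝟘 , refl)) (2·-square≡𝟘 (suc·-square≡𝟘 x⊙x≡𝟘 n))

  square≡𝟘⇒infinitesimal : ∀ {x} → x ⊙ x ≡ 𝟘 → IsInfinitesimal x
  square≡𝟘⇒infinitesimal {x} x⊙x≡𝟘 n =
    ≤-trans (⊙≡𝟘⇒≤¬ (suc·-square≡𝟘 x⊙x≡𝟘 n)) (¬-antitone-≤ (n · x , refl))

  θ⇒boolean⊕infinitesimal : ∀ {x} → InTheta x → IsBoolean⊕Infinitesimal x
  θ⇒boolean⊕infinitesimal {x} θx =
    b , x ⊙ ¬ b , 2·square-boolean x , square≡𝟘⇒infinitesimal ε⊙ε≡𝟘 , ≤⇒≡⊕⊙¬ θx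
    where
    b : Carrier
    b = 2 · (x ⊙ x)
    ε⊙ε≡𝟘 : x ⊙ ¬ b ⊙ (x ⊙ ¬ b) ≡ 𝟘
    ε⊙ε≡𝟘 = begin
      x ⊙ ¬ b ⊙ (x ⊙ ¬ b)    ≡⟨ ⊙-interchange x (¬ b) x (¬ b) ⟩
      x ⊙ x ⊙ (¬ b ⊙ ¬ b)    ≡⟨ cong (x ⊙ x ⊙_) (boolean⇒¬⊙¬≡¬ (2·square-boolean x)) ⟩
      x ⊙ x ⊙ ¬ b            ≡⟨ ≤⇒⊙¬≡𝟘 (x ⊙ x ⊕ 𝟘 , refl) ⟩
      𝟘                      ∎

  ¬infinitesimal∈θ⇒≡𝟙 : ∀ {x} → IsInfinitesimal x → InTheta (¬ x) → ¬ x ≡ 𝟙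
  ¬infinitesimal∈θ⇒≡𝟙 {x} x-inf θ¬x = 𝟙≤⇒≡𝟙 (subst (_≤ ¬ x) 2·[¬x⊙¬x]≡𝟙 θ¬x)
    where
    2·[¬x⊙¬x]≡𝟙 : 2 · (¬ x ⊙ ¬ x) ≡ 𝟙
    2·[¬x⊙¬x]≡𝟙 = begin
      2 · (¬ x ⊙ ¬ x)                  ≡⟨ sym (¬¬-involutive _) ⟩
      ¬ (¬ (2 · (¬ x ⊙ ¬ x)))          ≡⟨ cong ¬_ (¬-2·square (¬ x)) ⟩
      ¬ (2 · (¬ (¬ x) ⊙ ¬ (¬ x)))      ≡⟨ cong (λ t → ¬ (2 · (t ⊙ t))) (¬¬-involutive x) ⟩
      ¬ (2 · (x ⊙ x))                  ≡⟨ cong (λ t → ¬ (2 · t)) (infinitesimal⇒square≡𝟘 x-inf) ⟩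
      ¬ (2 · 𝟘)                        ≡⟨ cong ¬_ 2·𝟘≡𝟘 ⟩
      𝟙                                ∎

mainTheorem3 : ∀ {a : Level} (A : MVAlgebra a) → InVC A →
    let open MVAlgebra A in
      ((∀ x → IsBoolean x → InTheta x) × InTheta 𝟘 × InTheta 𝟙)
      × (∀ x → IsInfinitesimal x → InTheta x)
      × (∀ y → ((Σ Carrier λ x → IsInfinitesimal x × y ≡ ¬ x) × InTheta y) ⇔ y ≡ 𝟙)
      × (∀ x → InTheta x ⇔ (Σ Carrier λ b → Σ Carrier λ ε → IsBoolean b × IsInfinitesimal ε × x ≡ b ⊕ ε))
mainTheorem3 A inVC =
    ((λ _ → boolean⇒θ) , boolean⇒θ (⊕-identityʳ 𝟘) , boolean⇒θ (⊕-absorb 𝟙))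
  , (λ _ → infinitesimal⇒θ)
  , (λ _ → mk⇔ (λ { ((x , x-inf , refl) , θy) → ¬infinitesimal∈θ⇒≡𝟙 x-inf θy })
               (λ { refl → (𝟘 , (λ _ → ≤-maximum _) , refl) , boolean⇒θ (⊕-absorb 𝟙) }))
  , (λ _ → mk⇔ θ⇒boolean⊕infinitesimal boolean⊕infinitesimal⇒θ)
  where
  open MVAlgebra A
  open MVAlgebraProperties A
  open VCProperties A inVC
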